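{- If $U$ is a coloopless vector configuration with at least two more elements than its rank, then there are $\mathbf{u},\mathbf{v}\in U$ such that at least one of $U^+_{\mathbf{u},\mathbf{v}}$ or $U^-_{\mathbf{u},\mathbf{v}}$ is coloopless.
   Context: A vector configuration $U\subset\mathbb{Z}^d$ of rank $d$ is coloopless if there is a linear dependence $\sum_{\mathbf{u}\in U}\lambda_{\mathbf{u}}\mathbf{u}=0$ with $\lambda_{\mathbf{u}}\neq0$ for every $\mathbf{u}\in U$ (equivalently, $U\setminus\{\mathbf{u}\}$ still has rank $d$ for every $\mathbf{u}$). For $\mathbf{u},\mathbf{v}\in U$: $U^+_{\mathbf{u},\mathbf{v}}=U\setminus\{\mathbf{u},\mathbf{v}\}\cup\{\mathbf{u}+\mathbf{v}\}$ and $U^-_{\mathbf{u},\mathbf{v}}=U\setminus\{\mathbf{u},\mathbf{v}\}\cup\{\mathbf{u}-\mathbf{v}\}$. -}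

module Defs where

open import Data.Nat using (ℕ; _+_; _≤_)
open import Data.Integer as ℤ using (ℤ)
open import Data.Fin using (Fin)
open import Data.Fin.Properties as FinP using ()
open import Data.Vec using (Vec; replicate; zipWith; map)
open import Data.Vec.Properties using (≡-dec)
open import Data.List as List using (List; _∷_; []; foldr; filter; allFin; deduplicate)
open import Data.List.Membership.Propositional using (_∈_)
open import Data.Product using (Σ; ∃; _×_)
open import Relation.Binary.PropositionalEquality using (_≡_; _≢_)
open import Relation.Nullary using (¬_; ¬?)
open import Relation.Nullary.Decidable using (_×-dec_)

ℤ^ : ℕ → Set
ℤ^ d = Vec ℤ d

𝟎 : ∀ {d} → ℤ^ d
𝟎 = replicate _ (ℤ.+ 0)

_⊕_ : ∀ {d} → ℤ^ d → ℤ^ d → ℤ^ d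
_⊕_ = zipWith ℤ._+_

_⊖_ : ∀ {d} → ℤ^ d → ℤ^ d → ℤ^ d
_⊖_ = zipWith ℤ._-_

_·_ : ∀ {d} → ℤ → ℤ^ d → ℤ^ d
c · x = map (c ℤ.*_) x

_≟ᵥ_ : ∀ {d} (x y : ℤ^ d) → Relation.Nullary.Dec (x ≡ y)
_≟ᵥ_ = ≡-dec ℤ._≟_

linComb : ∀ {d} → (ℤ^ d → ℤ) → List (ℤ^ d) → ℤ^ d
linComb λ′ = foldr (λ x acc → (λ′ x · x) ⊕ acc) 𝟎

asSet : ∀ {d} → List (ℤ^ d) → List (ℤ^ d)
asSet = deduplicate _≟ᵥ_

-- A (finite) vector configuration, given by a list of its elements, is
-- coloopless if there is a linear dependence Σ_{u ∈ U} λ_u u = 0 with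
-- λ_u ≠ 0 for every u ∈ U.  (Integer coefficients: equivalent to rational /
-- real ones by clearing denominators.)  The sum ranges over the set of
-- elements, each vector counted once.
Coloopless : ∀ {d} → List (ℤ^ d) → Set
Coloopless L = Σ (_ → ℤ) λ λ′ →
  (∀ x → x ∈ L → λ′ x ≢ ℤ.+ 0) × (linComb λ′ (asSet L) ≡ 𝟎)

Injective : ∀ {n d} → (Fin n → ℤ^ d) → Set
Injective U = ∀ i j → U i ≡ U j → i ≡ j

elems : ∀ {n d} → (Fin n → ℤ^ d) → List (ℤ^ d)
elems U = List.map U (allFin _)

LinIndep : ∀ {k d} → (Fin k → ℤ^ d) → Set
LinIndep {k} w = ∀ (c : Fin k → ℤ) →
  foldr _⊕_ 𝟎 (List.map (λ i → c i · w i) (allFin k)) ≡ 𝟎 → ∀ i → c i ≡ ℤ.+ 0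

HasRank : ∀ {n} d → (Fin n → ℤ^ d) → Set
HasRank {n} d U = Σ (Fin d → Fin n) λ σ → LinIndep (λ i → U (σ i))

others : ∀ {n d} → (Fin n → ℤ^ d) → Fin n → Fin n → List (ℤ^ d)
others U i j = List.map U (filter (λ k → ¬? (k FinP.≟ i) ×-dec ¬? (k FinP.≟ j)) (allFin _))

Uplus : ∀ {n d} → (Fin n → ℤ^ d) → Fin n → Fin n → List (ℤ^ d)
Uplus U i j = (U i ⊕ U j) ∷ others U i j

Uminus : ∀ {n d} → (Fin n → ℤ^ d) → Fin n → Fin n → List (ℤ^ d)
Uminus U i j = (U i ⊖ U j) ∷ others U i j

-- A configuration is coloopless exactly when it has a dependence ν with no zero coefficient. If moreover
-- ν v = ± ν u, replacing ν u u + ν v v by ν u (u ± v) gives such a dependence of U^±_{u,v}, unless u ± v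
-- is an element w of U with ν u + ν w = 0.
-- A balanced ν of this kind comes from a nowhere-zero dependence Λ and a nonzero dependence μ of U ∖ {u},
-- which exists because n − 1 > d: for v minimising |μ v| / |Λ v| and |c| = |Λ u| + |Λ v|, the combination
-- μ v Λ + c μ vanishes nowhere and satisfies ν v = ± ν u for a suitable sign.
-- In the cancelling case δ = u ± v − w and ν − ν u δ are dependences with complementary supports, the
-- second one nonempty as soon as n ≥ 4. Merging the elements of largest weight |φ| in the two supports, for
-- a linear functional φ vanishing on no nonzero element of U, adds their weights, so the merged vector is
-- no other element of U. Three points on a line (n = 3, d = 1) are handled directly.

module Submission where

open import Defs

module Merging where
  open import Algebra.Bundles using (CommutativeMonoid)
  open import Algebra.Structures using (IsCommutativeMonoid)
  import Algebra.Properties.CommutativeMonoid.Sum as MonoidSum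
  import Algebra.Properties.CommutativeSemigroup as CommutativeSemigroupProperties
  open import Data.Bool using (if_then_else_)
  open import Data.Empty using (⊥; ⊥-elim)
  open import Data.Fin as Fin using (Fin; punchIn)
  open import Data.Fin.Patterns using (0F; 1F; 2F)
  import Data.Fin.Properties as FinP
  open import Data.Integer as ℤ using (ℤ; +_; +0; +[1+_]; -[1+_]; _*_; _+_; -_; _-_; ∣_∣)
  import Data.Integer.Properties as ℤP
  open import Data.Integer.Tactic.RingSolver using (solve-∀)
  open import Data.List as List using (List; []; _∷_; allFin; filter)
  import Data.List.Extrema as Extrema
  open import Data.List.Membership.Propositional using (_∈_; _∉_; find; lose)
  open import Data.List.Membership.Propositional.Properties
    using (∈-map⁺; ∈-map⁻; ∈-allFin; ∈-filter⁺; ∈-filter⁻; ∈-deduplicate⁺; ∈-deduplicate⁻)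
  import Data.List.Properties as ListP
  open import Data.List.Relation.Unary.All as All using ()
  open import Data.List.Relation.Unary.All.Properties using (all-filter)
  open import Data.List.Relation.Unary.AllPairs using (_∷_)
  open import Data.List.Relation.Unary.Any as Any using (here; there)
  open import Data.List.Relation.Unary.Any.Properties using (lookup-index)
  open import Data.List.Relation.Unary.Unique.Propositional using (Unique)
  import Data.List.Relation.Unary.Unique.Propositional.Properties as Unique
  import Data.List.Relation.Unary.Unique.DecPropositional.Properties as UniqueDec
  open import Data.Nat as ℕ using (ℕ; zero; suc)
  import Data.Nat.Properties as ℕP
  import Data.Nat.Tactic.RingSolver as ℕSolver
  open import Data.Product using (Σ; ∃; ∃₂; _×_; _,_; proj₁; proj₂)
  open import Data.Rational.Unnormalised as ℚᵘ using (ℚᵘ; mkℚᵘ; *≤*)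
  import Data.Rational.Unnormalised.Properties as ℚᵘP
  open import Data.Sign as Sign using (Sign)
  open import Data.Sum using (_⊎_; inj₁; inj₂; [_,_]′)
  open import Data.Vec as Vec using ([]; _∷_)
  open import Data.Vec.Functional using (insertAt) renaming (_∷_ to _∷ᶠ_)
  open import Data.Vec.Functional.Properties using (insertAt-lookup; insertAt-punchIn)
  open import Data.Vec.Properties using (zipWith-assoc; zipWith-comm; zipWith-identityˡ; zipWith-identityʳ)
  open import Data.Vec.Relation.Unary.All as VecAll using () renaming (All to VecAll)
  open import Function using (_∘_)
  open import Level using (0ℓ)
  open import Relation.Binary.Bundles using (TotalOrder)
  open import Relation.Binary.Definitions using (DecidableEquality)
  open import Relation.Binary.PropositionalEquality
  open import Relation.Nullary using (Dec; yes; no; ¬?; does)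
  open import Relation.Nullary.Decidable using (dec-true; dec-false; _×-dec_; decidable-stable)
  open import Relation.Unary using (Pred; Decidable)

  module ℤΣ = MonoidSum ℤP.+-0-commutativeMonoid
  module ℕΣ = MonoidSum ℕP.+-0-commutativeMonoid

  signed : Sign → ℤ → ℤ
  signed Sign.+ x = x
  signed Sign.- x = - x

  signed-≢0 : ∀ σ {x} → x ≢ + 0 → signed σ x ≢ + 0
  signed-≢0 Sign.+ x≢0 = x≢0
  signed-≢0 Sign.- x≢0 -x≡0 = x≢0 (trans (sym (ℤP.neg-involutive _)) (cong -_ -x≡0))

  align : ℤ → ℤ → Sign
  align +[1+ _ ] -[1+ _ ] = Sign.-
  align -[1+ _ ] +[1+ _ ] = Sign.-
  align _        _        = Sign.+

  ∣+align∣ : ∀ p q → ∣ p + signed (align p q) q ∣ ≡ ∣ p ∣ ℕ.+ ∣ q ∣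
  ∣+align∣ +0       q        = cong ∣_∣ (ℤP.+-identityˡ q)
  ∣+align∣ +[1+ a ] +0       = refl
  ∣+align∣ +[1+ a ] +[1+ b ] = refl
  ∣+align∣ +[1+ a ] -[1+ b ] = refl
  ∣+align∣ -[1+ a ] +0       = trans (cong ∣_∣ (ℤP.+-identityʳ -[1+ a ])) (sym (ℕP.+-identityʳ (suc a)))
  ∣+align∣ -[1+ a ] +[1+ b ] = cong suc (sym (ℕP.+-suc a b))
  ∣+align∣ -[1+ a ] -[1+ b ] = cong suc (sym (ℕP.+-suc a b))

  *-≢0 : ∀ {i j} → i ≢ + 0 → j ≢ + 0 → i * j ≢ + 0
  *-≢0 {i} i≢0 j≢0 ij≡0 = [ i≢0 , j≢0 ]′ (ℤP.i*j≡0⇒i≡0∨j≡0 i ij≡0)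

  i≢0⇒∣i∣≢0 : ∀ {i} → i ≢ + 0 → ∣ i ∣ ≢ 0
  i≢0⇒∣i∣≢0 i≢0 = i≢0 ∘ ℤP.∣i∣≡0⇒i≡0

  +≡0⇒≡- : ∀ {a b} → a + b ≡ + 0 → a ≡ - b
  +≡0⇒≡- {a} {b} a+b≡0 = trans (shift a b) (trans (cong (_- b) a+b≡0) (ℤP.+-identityˡ (- b)))
    where
    shift : ∀ a b → a ≡ (a + b) - b
    shift = solve-∀

  *+*≡0⇒∣*∣≡∣*∣ : ∀ {a b c e} → a * b + c * e ≡ + 0 →
    ∣ a ∣ ℕ.* ∣ b ∣ ≡ ∣ c ∣ ℕ.* ∣ e ∣
  *+*≡0⇒∣*∣≡∣*∣ {a} {b} {c} {e} sum≡0 = begin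
    ∣ a ∣ ℕ.* ∣ b ∣  ≡⟨ ℤP.abs-* a b ⟨
    ∣ a * b ∣        ≡⟨ cong ∣_∣ (+≡0⇒≡- {a * b} {c * e} sum≡0) ⟩
    ∣ - (c * e) ∣    ≡⟨ ℤP.∣-i∣≡∣i∣ (c * e) ⟩
    ∣ c * e ∣        ≡⟨ ℤP.abs-* c e ⟩
    ∣ c ∣ ℕ.* ∣ e ∣  ∎
    where open ≡-Reasoning

  m+n≤m⇒n≡0 : ∀ m {n} → m ℕ.+ n ℕ.≤ m → n ≡ 0
  m+n≤m⇒n≡0 m {n} le =
    ℕP.n≤0⇒n≡0 (ℕP.+-cancelˡ-≤ m n 0 (subst (m ℕ.+ n ℕ.≤_) (sym (ℕP.+-identityʳ m)) le))

  m+n≤n⇒m≡0 : ∀ m {n} → m ℕ.+ n ℕ.≤ n → m ≡ 0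
  m+n≤n⇒m≡0 m {n} le = m+n≤m⇒n≡0 n (subst (ℕ._≤ n) (ℕP.+-comm m n) le)

  [m+n]*o≤o*m⇒n*o≡0 : ∀ m n o → (m ℕ.+ n) ℕ.* o ℕ.≤ o ℕ.* m → n ℕ.* o ≡ 0
  [m+n]*o≤o*m⇒n*o≡0 m n o le = m+n≤m⇒n≡0 (o ℕ.* m) (subst (ℕ._≤ o ℕ.* m) (expand m n o) le)
    where
    expand : ∀ m n o → (m ℕ.+ n) ℕ.* o ≡ o ℕ.* m ℕ.+ n ℕ.* o
    expand = ℕSolver.solve-∀

  combine : ∀ {d} → Sign → ℤ^ d → ℤ^ d → ℤ^ d
  combine Sign.+ = _⊕_
  combine Sign.- = _⊖_

  ⊕-isCommutativeMonoid : ∀ d → IsCommutativeMonoid _≡_ (_⊕_ {d}) 𝟎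
  ⊕-isCommutativeMonoid d = record
    { isMonoid = record
      { isSemigroup = record
        { isMagma = record { isEquivalence = isEquivalence ; ∙-cong = cong₂ _⊕_ }
        ; assoc   = zipWith-assoc ℤP.+-assoc
        }
      ; identity = zipWith-identityˡ ℤP.+-identityˡ , zipWith-identityʳ ℤP.+-identityʳ
      }
    ; comm = zipWith-comm ℤP.+-comm
    }

  ⊕-commutativeMonoid : ℕ → CommutativeMonoid 0ℓ 0ℓ
  ⊕-commutativeMonoid d = record { isCommutativeMonoid = ⊕-isCommutativeMonoid d }

  module ⊕ {d : ℕ} = CommutativeMonoid (⊕-commutativeMonoid d)
  module ⊕-Properties {d : ℕ} = CommutativeSemigroupProperties (⊕.commutativeSemigroup {d})
  module Σᵛ {d : ℕ} = MonoidSum (⊕-commutativeMonoid d)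

  ·-distribˡ-⊕ : ∀ {d} c (x y : ℤ^ d) → c · (x ⊕ y) ≡ (c · x) ⊕ (c · y)
  ·-distribˡ-⊕ c []      []      = refl
  ·-distribˡ-⊕ c (a ∷ x) (b ∷ y) = cong₂ _∷_ (ℤP.*-distribˡ-+ c a b) (·-distribˡ-⊕ c x y)

  ·-distribʳ-+ : ∀ {d} a b (x : ℤ^ d) → (a + b) · x ≡ (a · x) ⊕ (b · x)
  ·-distribʳ-+ a b []      = refl
  ·-distribʳ-+ a b (c ∷ x) = cong₂ _∷_ (ℤP.*-distribʳ-+ c a b) (·-distribʳ-+ a b x)

  ·-assoc : ∀ {d} a b (x : ℤ^ d) → (a * b) · x ≡ a · (b · x)
  ·-assoc a b []      = refl
  ·-assoc a b (c ∷ x) = cong₂ _∷_ (ℤP.*-assoc a b c) (·-assoc a b x)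

  ·-zeroˡ : ∀ {d} (x : ℤ^ d) → (+ 0) · x ≡ 𝟎
  ·-zeroˡ []      = refl
  ·-zeroˡ (c ∷ x) = cong (+ 0 ∷_) (·-zeroˡ x)

  ·-zeroʳ : ∀ {d} c → c · 𝟎 {d} ≡ 𝟎
  ·-zeroʳ {zero}  c = refl
  ·-zeroʳ {suc d} c = cong₂ _∷_ (ℤP.*-zeroʳ c) (·-zeroʳ c)

  ·-combine : ∀ {d} σ c (x y : ℤ^ d) → c · combine σ x y ≡ (c · x) ⊕ (signed σ c · y)
  ·-combine Sign.+ c x       y       = ·-distribˡ-⊕ c x y
  ·-combine Sign.- c []      []      = refl
  ·-combine Sign.- c (a ∷ x) (b ∷ y) = cong₂ _∷_ (distrib c a b) (·-combine Sign.- c x y)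
    where
    distrib : ∀ c a b → c * (a - b) ≡ c * a + - c * b
    distrib = solve-∀

  combine-𝟎ʳ : ∀ {d} σ (x : ℤ^ d) → combine σ x 𝟎 ≡ x
  combine-𝟎ʳ Sign.+ x       = ⊕.identityʳ x
  combine-𝟎ʳ Sign.- []      = refl
  combine-𝟎ʳ Sign.- (a ∷ x) = cong₂ _∷_ (ℤP.+-identityʳ a) (combine-𝟎ʳ Sign.- x)

  ℤ^0-trivial : (x : ℤ^ 0) → x ≡ 𝟎
  ℤ^0-trivial [] = refl

  ∷-head-tail : ∀ {d} (x : ℤ^ (suc d)) → x ≡ Vec.head x ∷ Vec.tail x
  ∷-head-tail (a ∷ x) = refl

  ·-sum : ∀ {d n} c (f : Fin n → ℤ^ d) → c · Σᵛ.sum f ≡ Σᵛ.sum (λ i → c · f i)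
  ·-sum {n = zero}  c f = ·-zeroʳ c
  ·-sum {n = suc n} c f =
    trans (·-distribˡ-⊕ c _ _) (cong ((c · f Fin.zero) ⊕_) (·-sum c (f ∘ Fin.suc)))

  ℤ-sum-· : ∀ {d n} (e : Fin n → ℤ) (x : ℤ^ d) → ℤΣ.sum e · x ≡ Σᵛ.sum (λ j → e j · x)
  ℤ-sum-· {n = zero}  e x = ·-zeroˡ x
  ℤ-sum-· {n = suc n} e x =
    trans (·-distribʳ-+ (e Fin.zero) _ x) (cong ((e Fin.zero · x) ⊕_) (ℤ-sum-· (e ∘ Fin.suc) x))

  sum-supported-at : ∀ {d n} (k : Fin n) (f : Fin n → ℤ^ d) →
    (∀ i → i ≢ k → f i ≡ 𝟎) → Σᵛ.sum f ≡ f k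
  sum-supported-at {n = suc n} k f f≡𝟎 = begin
    Σᵛ.sum f                              ≡⟨ Σᵛ.sum-remove f ⟩
    f k ⊕ Σᵛ.sum (λ j → f (punchIn k j))  ≡⟨ cong (f k ⊕_) rest≡𝟎 ⟩
    f k ⊕ 𝟎                               ≡⟨ ⊕.identityʳ (f k) ⟩
    f k                                   ∎
    where
    open ≡-Reasoning
    rest≡𝟎 : Σᵛ.sum (λ j → f (punchIn k j)) ≡ 𝟎
    rest≡𝟎 = trans (Σᵛ.sum-cong-≗ (λ j → f≡𝟎 (punchIn k j) (FinP.punchInᵢ≢i k j)))
                   (Σᵛ.sum-replicate-zero n)

  lc : ∀ {d n} → (Fin n → ℤ^ d) → (Fin n → ℤ) → ℤ^ d
  lc U c = Σᵛ.sum (λ i → c i · U i)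

  IsDependence : ∀ {d n} → (Fin n → ℤ^ d) → (Fin n → ℤ) → Set
  IsDependence U c = lc U c ≡ 𝟎

  module PointMass {A : Set} (_≟_ : DecidableEquality A) where

    [_↦_] : A → ℤ → A → ℤ
    [ a ↦ c ] x = if does (x ≟ a) then c else + 0

    ↦-self : ∀ a c → [ a ↦ c ] a ≡ c
    ↦-self a c rewrite dec-true (a ≟ a) refl = refl

    ↦-other : ∀ {a x} c → x ≢ a → [ a ↦ c ] x ≡ + 0
    ↦-other {a} {x} c x≢a rewrite dec-false (x ≟ a) x≢a = refl

  open module PointMassFin {n} = PointMass (FinP._≟_ {n})
  open module PointMassVec {d} = PointMass (_≟ᵥ_ {d})
    renaming ([_↦_] to ⟦_↦_⟧; ↦-self to ⟦↦⟧-self; ↦-other to ⟦↦⟧-other)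

  [_↦_,_↦_,_↦_] : ∀ {n} → Fin n → ℤ → Fin n → ℤ → Fin n → ℤ → Fin n → ℤ
  [ u ↦ a , v ↦ b , w ↦ c ] i = [ u ↦ a ] i + ([ v ↦ b ] i + [ w ↦ c ] i)

  module _ {n} {u v w : Fin n} (a b c : ℤ) where

    ↦₃-first : u ≢ v → u ≢ w → [ u ↦ a , v ↦ b , w ↦ c ] u ≡ a
    ↦₃-first u≢v u≢w rewrite ↦-self u a | ↦-other b u≢v | ↦-other c u≢w = ℤP.+-identityʳ a

    ↦₃-second : v ≢ u → v ≢ w → [ u ↦ a , v ↦ b , w ↦ c ] v ≡ b
    ↦₃-second v≢u v≢w rewrite ↦-other a v≢u | ↦-self v b | ↦-other c v≢w =
      trans (ℤP.+-identityˡ _) (ℤP.+-identityʳ b)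

    ↦₃-third : w ≢ u → w ≢ v → [ u ↦ a , v ↦ b , w ↦ c ] w ≡ c
    ↦₃-third w≢u w≢v rewrite ↦-other a w≢u | ↦-other b w≢v | ↦-self w c =
      trans (ℤP.+-identityˡ _) (ℤP.+-identityˡ c)

    ↦₃-outside : ∀ {i} → i ≢ u → i ≢ v → i ≢ w → [ u ↦ a , v ↦ b , w ↦ c ] i ≡ + 0
    ↦₃-outside i≢u i≢v i≢w rewrite ↦-other a i≢u | ↦-other b i≢v | ↦-other c i≢w = refl

  restrict : ∀ {n p} {P : Pred (Fin n) p} → Decidable P → (Fin n → ℤ) → Fin n → ℤ
  restrict P? c i = if does (P? i) then c i else + 0

  -- The filter of Defs.others: others U a b is map U (filter (outside? a b) (allFin n)) by definition.
  outside? : ∀ {n} (a b : Fin n) → Decidable (λ k → k ≢ a × k ≢ b)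
  outside? a b k = ¬? (k FinP.≟ a) ×-dec ¬? (k FinP.≟ b)

  module _ {d n : ℕ} (U : Fin n → ℤ^ d) where

    lc-+ : ∀ (c c′ : Fin n → ℤ) → lc U (λ i → c i + c′ i) ≡ lc U c ⊕ lc U c′
    lc-+ c c′ = trans (Σᵛ.sum-cong-≗ (λ i → ·-distribʳ-+ (c i) (c′ i) (U i)))
                      (Σᵛ.∑-distrib-+ (λ i → c i · U i) (λ i → c′ i · U i))

    lc-* : ∀ a (c : Fin n → ℤ) → lc U (λ i → a * c i) ≡ a · lc U c
    lc-* a c = trans (Σᵛ.sum-cong-≗ (λ i → ·-assoc a (c i) (U i))) (sym (·-sum a (λ i → c i · U i)))

    lc-↦ : ∀ k a → lc U [ k ↦ a ] ≡ a · U k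
    lc-↦ k a = trans (sum-supported-at k _ vanishes) (cong (_· U k) (↦-self k a))
      where
      vanishes : ∀ i → i ≢ k → [ k ↦ a ] i · U i ≡ 𝟎
      vanishes i i≢k = trans (cong (_· U i) (↦-other a i≢k)) (·-zeroˡ (U i))

    lc-↦₃ : ∀ u v w a b c → lc U [ u ↦ a , v ↦ b , w ↦ c ] ≡ (a · U u) ⊕ ((b · U v) ⊕ (c · U w))
    lc-↦₃ u v w a b c =
      trans (lc-+ [ u ↦ a ] _)
            (cong₂ _⊕_ (lc-↦ u a) (trans (lc-+ [ v ↦ b ] _) (cong₂ _⊕_ (lc-↦ v b) (lc-↦ w c))))

    lc-pair-split : ∀ {a b} c → a ≢ b →
      lc U c ≡ (c a · U a) ⊕ ((c b · U b) ⊕ lc U (restrict (outside? a b) c))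
    lc-pair-split {a} {b} c a≢b =
      trans (Σᵛ.sum-cong-≗ (λ i → cong (_· U i) (split i)))
        (trans (lc-+ [ a ↦ c a ] _) (cong₂ _⊕_ (lc-↦ a (c a))
          (trans (lc-+ [ b ↦ c b ] _) (cong (_⊕ lc U (restrict (outside? a b) c)) (lc-↦ b (c b))))))
      where
      split : ∀ i → c i ≡ [ a ↦ c a ] i + ([ b ↦ c b ] i + restrict (outside? a b) c i)
      split i with i FinP.≟ a | i FinP.≟ b
      ... | yes refl | yes refl = ⊥-elim (a≢b refl)
      ... | yes refl | no _     = sym (ℤP.+-identityʳ (c i))
      ... | no _     | yes refl = sym (trans (ℤP.+-identityˡ _) (ℤP.+-identityʳ (c i)))
      ... | no _     | no _     = sym (trans (ℤP.+-identityˡ _) (ℤP.+-identityˡ (c i)))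

    dependence-combination : ∀ a b {c c′} → IsDependence U c → IsDependence U c′ →
      IsDependence U (λ i → a * c i + b * c′ i)
    dependence-combination a b {c} {c′} c-dep c′-dep = begin
      lc U (λ i → a * c i + b * c′ i)               ≡⟨ lc-+ (λ i → a * c i) (λ i → b * c′ i) ⟩
      lc U (λ i → a * c i) ⊕ lc U (λ i → b * c′ i)  ≡⟨ cong₂ _⊕_ (lc-* a c) (lc-* b c′) ⟩
      (a · lc U c) ⊕ (b · lc U c′)                  ≡⟨ cong₂ (λ x y → (a · x) ⊕ (b · y)) c-dep c′-dep ⟩
      (a · 𝟎) ⊕ (b · 𝟎)                             ≡⟨ cong₂ _⊕_ (·-zeroʳ a) (·-zeroʳ b) ⟩
      𝟎 ⊕ 𝟎                                         ≡⟨ ⊕.identityˡ 𝟎 ⟩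
      𝟎                                             ∎
      where open ≡-Reasoning

    triangle-dependence : ∀ σ {u v w} → U w ≡ combine σ (U u) (U v) →
      IsDependence U [ u ↦ + 1 , v ↦ signed σ (+ 1) , w ↦ - + 1 ]
    triangle-dependence σ {u} {v} {w} Uw≡t = begin
      lc U [ u ↦ + 1 , v ↦ signed σ (+ 1) , w ↦ - + 1 ]
        ≡⟨ lc-↦₃ u v w _ _ _ ⟩
      ((+ 1) · U u) ⊕ ((signed σ (+ 1) · U v) ⊕ ((- + 1) · U w))
        ≡⟨ ⊕.assoc _ _ _ ⟨
      (((+ 1) · U u) ⊕ (signed σ (+ 1) · U v)) ⊕ ((- + 1) · U w)
        ≡⟨ cong (_⊕ ((- + 1) · U w)) (·-combine σ (+ 1) (U u) (U v)) ⟨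
      ((+ 1) · combine σ (U u) (U v)) ⊕ ((- + 1) · U w)
        ≡⟨ cong (λ z → ((+ 1) · z) ⊕ ((- + 1) · U w)) Uw≡t ⟨
      ((+ 1) · U w) ⊕ ((- + 1) · U w)
        ≡⟨ ·-distribʳ-+ (+ 1) (- + 1) (U w) ⟨
      (+ 0) · U w
        ≡⟨ ·-zeroˡ (U w) ⟩
      𝟎 ∎
      where open ≡-Reasoning

  -- Elimination

  lc-0∷ : ∀ {d n} (W : Fin n → ℤ^ d) c → lc (λ i → + 0 ∷ W i) c ≡ + 0 ∷ lc W c
  lc-0∷ {n = zero}  W c = refl
  lc-0∷ {n = suc n} W c =
    trans (cong ((c Fin.zero · (+ 0 ∷ W Fin.zero)) ⊕_) (lc-0∷ (W ∘ Fin.suc) (c ∘ Fin.suc)))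
          (cong (λ a → a ∷ ((c Fin.zero · W Fin.zero) ⊕ lc (W ∘ Fin.suc) (c ∘ Fin.suc)))
                (trans (ℤP.+-identityʳ _) (ℤP.*-zeroʳ (c Fin.zero))))

  dependence-of-tails : ∀ {d n} (W : Fin n → ℤ^ (suc d)) → (∀ i → Vec.head (W i) ≡ + 0) →
    ∀ {c} → IsDependence (Vec.tail ∘ W) c → IsDependence W c
  dependence-of-tails W heads≡0 {c} tails-dep = begin
    lc W c                             ≡⟨ Σᵛ.sum-cong-≗ (λ i → cong (c i ·_) (W≡0∷ i)) ⟩
    lc (λ i → + 0 ∷ Vec.tail (W i)) c  ≡⟨ lc-0∷ (Vec.tail ∘ W) c ⟩
    + 0 ∷ lc (Vec.tail ∘ W) c          ≡⟨ cong (+ 0 ∷_) tails-dep ⟩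
    𝟎                                  ∎
    where
    open ≡-Reasoning
    W≡0∷ : ∀ i → W i ≡ + 0 ∷ Vec.tail (W i)
    W≡0∷ i = trans (∷-head-tail (W i)) (cong (λ a → a ∷ Vec.tail (W i)) (heads≡0 i))

  module _ {d m : ℕ} (W : Fin (suc m) → ℤ^ d) (k : Fin (suc m)) (a : ℤ) (h : Fin m → ℤ) where

    eliminate : Fin m → ℤ^ d
    eliminate j = (a · W (punchIn k j)) ⊕ ((- h j) · W k)

    backSubstitute : (Fin m → ℤ) → Fin (suc m) → ℤ
    backSubstitute c = insertAt (λ j → c j * a) k (ℤΣ.sum (λ j → c j * - h j))

    lc-backSubstitute : ∀ c → lc W (backSubstitute c) ≡ lc eliminate c
    lc-backSubstitute c = begin
      lc W (backSubstitute c)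
        ≡⟨ Σᵛ.sum-remove {i = k} (λ i → backSubstitute c i · W i) ⟩
      (backSubstitute c k · W k) ⊕ Σᵛ.sum (λ j → backSubstitute c (punchIn k j) · W (punchIn k j))
        ≡⟨ cong₂ _⊕_ (cong (_· W k) (insertAt-lookup _ k _))
                     (Σᵛ.sum-cong-≗ (λ j → cong (_· W (punchIn k j)) (insertAt-punchIn _ k _ j))) ⟩
      (ℤΣ.sum e · W k) ⊕ Σᵛ.sum (λ j → (c j * a) · W (punchIn k j))
        ≡⟨ cong (_⊕ Σᵛ.sum (λ j → (c j * a) · W (punchIn k j))) (ℤ-sum-· e (W k)) ⟩
      Σᵛ.sum (λ j → e j · W k) ⊕ Σᵛ.sum (λ j → (c j * a) · W (punchIn k j))
        ≡⟨ ⊕.comm _ _ ⟩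
      Σᵛ.sum (λ j → (c j * a) · W (punchIn k j)) ⊕ Σᵛ.sum (λ j → e j · W k)
        ≡⟨ Σᵛ.∑-distrib-+ (λ j → (c j * a) · W (punchIn k j)) (λ j → e j · W k) ⟨
      Σᵛ.sum (λ j → ((c j * a) · W (punchIn k j)) ⊕ (e j · W k))
        ≡⟨ Σᵛ.sum-cong-≗ expand ⟨
      lc eliminate c
        ∎
      where
      open ≡-Reasoning
      e : Fin m → ℤ
      e j = c j * - h j
      expand : ∀ j → c j · eliminate j ≡ ((c j * a) · W (punchIn k j)) ⊕ (e j · W k)
      expand j = trans (·-distribˡ-⊕ (c j) _ _)
                       (cong₂ _⊕_ (sym (·-assoc (c j) a _)) (sym (·-assoc (c j) (- h j) (W k))))

  head-eliminate : ∀ {d} (x y : ℤ^ (suc d)) → Vec.head ((Vec.head y · x) ⊕ ((- Vec.head x) · y)) ≡ + 0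
  head-eliminate (p ∷ x) (q ∷ y) = cancel p q
    where
    cancel : ∀ p q → q * p + - p * q ≡ + 0
    cancel = solve-∀

  nontrivialDependence : ∀ {d m} → d ℕ.< m → (W : Fin m → ℤ^ d) →
    ∃ λ c → (∃ λ i → c i ≢ + 0) × IsDependence W c
  nontrivialDependence {zero} {suc m} _ W = (λ _ → + 1) , (Fin.zero , λ ()) , ℤ^0-trivial _
  nontrivialDependence {suc d} {suc m} (ℕ.s≤s d<m) W with FinP.any? (λ k → ¬? (Vec.head (W k) ℤ.≟ + 0))
  ... | no no-pivot =
    let c , c≢0 , c-dep = nontrivialDependence (ℕP.m<n⇒m<1+n d<m) (Vec.tail ∘ W)
    in  c , c≢0 , dependence-of-tails W heads≡0 {c} c-dep
    where
    heads≡0 : ∀ k → Vec.head (W k) ≡ + 0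
    heads≡0 k = decidable-stable (Vec.head (W k) ℤ.≟ + 0) (λ head≢0 → no-pivot (k , head≢0))
  ... | yes (k , pivot) =
    let c , (j , cⱼ≢0) , c-dep = nontrivialDependence d<m (Vec.tail ∘ reduced)
    in  backSubstitute W k a h c
      , (punchIn k j , λ c′≡0 → *-≢0 cⱼ≢0 pivot (trans (sym (insertAt-punchIn _ k _ j)) c′≡0))
      , trans (lc-backSubstitute W k a h c)
              (dependence-of-tails reduced (λ j → head-eliminate (W (punchIn k j)) (W k)) {c} c-dep)
    where
    a : ℤ
    a = Vec.head (W k)
    h : Fin m → ℤ
    h j = Vec.head (W (punchIn k j))
    reduced : Fin m → ℤ^ (suc d)
    reduced = eliminate W k a h

  value : ∀ {d} → List (ℤ × ℤ^ d) → ℤ^ d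
  value = List.foldr (λ (c , z) acc → (c · z) ⊕ acc) 𝟎

  coeff : ∀ {d} → List (ℤ × ℤ^ d) → ℤ^ d → ℤ
  coeff []             y = + 0
  coeff ((c , z) ∷ ps) y = ⟦ z ↦ c ⟧ y + coeff ps y

  module _ {d : ℕ} where

    linComb-cong : ∀ {f g : ℤ^ d → ℤ} D → (∀ {y} → y ∈ D → f y ≡ g y) →
      linComb f D ≡ linComb g D
    linComb-cong []      f≡g = refl
    linComb-cong (y ∷ D) f≡g =
      cong₂ (λ a s → (a · y) ⊕ s) (f≡g (here refl)) (linComb-cong D (f≡g ∘ there))

    linComb-+ : ∀ (f g : ℤ^ d → ℤ) D → linComb (λ y → f y + g y) D ≡ linComb f D ⊕ linComb g D
    linComb-+ f g []      = sym (⊕.identityˡ 𝟎)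
    linComb-+ f g (y ∷ D) =
      trans (cong₂ _⊕_ (·-distribʳ-+ (f y) (g y) y) (linComb-+ f g D)) (⊕-Properties.interchange _ _ _ _)

    linComb-zero : ∀ (f : ℤ^ d → ℤ) D → (∀ {y} → y ∈ D → f y ≡ + 0) → linComb f D ≡ 𝟎
    linComb-zero f []      f≡0 = refl
    linComb-zero f (y ∷ D) f≡0 =
      trans (cong₂ _⊕_ (trans (cong (_· y) (f≡0 (here refl))) (·-zeroˡ y))
                       (linComb-zero f D (f≡0 ∘ there)))
            (⊕.identityˡ 𝟎)

    linComb-↦ : ∀ {z} c D → Unique D → z ∈ D → linComb ⟦ z ↦ c ⟧ D ≡ c · z
    linComb-↦ c (z ∷ D) (z∉D ∷ _) (here refl) =
      trans (cong₂ _⊕_ (cong (_· z) (⟦↦⟧-self z c))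
                       (linComb-zero _ D (λ y∈D → ⟦↦⟧-other c (All.lookup z∉D y∈D ∘ sym))))
            (⊕.identityʳ (c · z))
    linComb-↦ c (y ∷ D) (y∉D ∷ D!) (there z∈D) =
      trans (cong₂ _⊕_ (trans (cong (_· y) (⟦↦⟧-other c (All.lookup y∉D z∈D))) (·-zeroˡ y))
                       (linComb-↦ c D D! z∈D))
            (⊕.identityˡ (c · _))

    linComb-coeff : ∀ (ps : List (ℤ × ℤ^ d)) D → Unique D → (∀ {p} → p ∈ ps → proj₂ p ∈ D) →
      linComb (coeff ps) D ≡ value ps
    linComb-coeff []             D D! ps⊆D = linComb-zero (coeff []) D (λ _ → refl)
    linComb-coeff ((c , z) ∷ ps) D D! ps⊆D =
      trans (linComb-+ ⟦ z ↦ c ⟧ (coeff ps) D)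
            (cong₂ _⊕_ (linComb-↦ c D D! (ps⊆D (here refl))) (linComb-coeff ps D D! (ps⊆D ∘ there)))

    coloopless-intro : ∀ (ps : List (ℤ × ℤ^ d)) → value ps ≡ 𝟎 →
      (∀ {y} → y ∈ List.map proj₂ ps → coeff ps y ≢ + 0) → Coloopless (List.map proj₂ ps)
    coloopless-intro ps value≡𝟎 coeff≢0 =
      coeff ps , (λ _ → coeff≢0) ,
      trans (linComb-coeff ps _ (UniqueDec.deduplicate-! _≟ᵥ_ _) (∈-deduplicate⁺ _≟ᵥ_ ∘ ∈-map⁺ proj₂))
            value≡𝟎

  terms : ∀ {d n} → (Fin n → ℤ^ d) → (Fin n → ℤ) → List (Fin n) → List (ℤ × ℤ^ d)
  terms U c = List.map (λ k → c k , U k)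

  module _ {d n : ℕ} (U : Fin n → ℤ^ d) where

    value-terms-tabulate : ∀ {m} c (g : Fin m → Fin n) →
      value (terms U c (List.tabulate g)) ≡ Σᵛ.sum (λ i → c (g i) · U (g i))
    value-terms-tabulate {zero}  c g = refl
    value-terms-tabulate {suc m} c g =
      cong ((c (g Fin.zero) · U (g Fin.zero)) ⊕_) (value-terms-tabulate c (g ∘ Fin.suc))

    value-terms-filter : ∀ {p} {P : Pred (Fin n) p} (P? : Decidable P) c K →
      value (terms U c (filter P? K)) ≡ value (terms U (restrict P? c) K)
    value-terms-filter P? c []      = refl
    value-terms-filter P? c (k ∷ K) with P? k
    ... | yes _ = cong ((c k · U k) ⊕_) (value-terms-filter P? c K)
    ... | no  _ =
      trans (value-terms-filter P? c K) (sym (trans (cong (_⊕ _) (·-zeroˡ (U k))) (⊕.identityˡ _)))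

    coeff-terms-∉ : ∀ c {y} K → (∀ {k} → k ∈ K → U k ≢ y) → coeff (terms U c K) y ≡ + 0
    coeff-terms-∉ c []      U≢y = refl
    coeff-terms-∉ c (k ∷ K) U≢y =
      cong₂ _+_ (⟦↦⟧-other (c k) (U≢y (here refl) ∘ sym)) (coeff-terms-∉ c K (U≢y ∘ there))

    coeff-terms-∈ : Injective U → ∀ c {j} K → Unique K → j ∈ K → coeff (terms U c K) (U j) ≡ c j
    coeff-terms-∈ U-inj c (j ∷ K) (j∉K ∷ _) (here refl) =
      trans (cong₂ _+_ (⟦↦⟧-self (U j) (c j))
                       (coeff-terms-∉ c K (λ k∈K Uk≡Uj → All.lookup j∉K k∈K (sym (U-inj _ _ Uk≡Uj)))))
            (ℤP.+-identityʳ (c j))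
    coeff-terms-∈ U-inj c (k ∷ K) (k∉K ∷ K!) (there j∈K) =
      trans (cong₂ _+_ (⟦↦⟧-other (c k) (λ Uj≡Uk → All.lookup k∉K j∈K (sym (U-inj _ _ Uj≡Uk))))
                       (coeff-terms-∈ U-inj c K K! j∈K))
            (ℤP.+-identityˡ (c _))

    nowhereZeroDependence : Injective U → Coloopless (elems U) →
      ∃ λ Λ → (∀ i → Λ i ≢ + 0) × IsDependence U Λ
    nowhereZeroDependence U-inj (λ′ , λ′≢0 , λ′-dep) =
      Λ , (λ i → λ′≢0 (U i) (∈-map⁺ U (∈-allFin i))) , Λ-dep
      where
      Λ : Fin n → ℤ
      Λ = λ′ ∘ U
      D : List (ℤ^ d)
      D = asSet (elems U)
      ps : List (ℤ × ℤ^ d)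
      ps = terms U Λ (allFin n)
      ps⊆D : ∀ {p} → p ∈ ps → proj₂ p ∈ D
      ps⊆D p∈ps with ∈-map⁻ _ p∈ps
      ... | k , k∈ , refl = ∈-deduplicate⁺ _≟ᵥ_ (∈-map⁺ U k∈)
      coeff≡λ′ : ∀ {y} → y ∈ D → coeff ps y ≡ λ′ y
      coeff≡λ′ y∈D with ∈-map⁻ U (∈-deduplicate⁻ _≟ᵥ_ (elems U) y∈D)
      ... | j , j∈ , refl = coeff-terms-∈ U-inj Λ (allFin n) (Unique.allFin⁺ n) j∈
      Λ-dep : IsDependence U Λ
      Λ-dep = begin
        lc U Λ                ≡⟨ value-terms-tabulate Λ (λ i → i) ⟨
        value ps              ≡⟨ linComb-coeff ps D (UniqueDec.deduplicate-! _≟ᵥ_ (elems U)) ps⊆D ⟨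
        linComb (coeff ps) D  ≡⟨ linComb-cong D coeff≡λ′ ⟩
        linComb λ′ D          ≡⟨ λ′-dep ⟩
        𝟎                     ∎
        where open ≡-Reasoning

  -- Merging along a balanced dependence

  HasColooplessMerge : ∀ {d n} → (Fin n → ℤ^ d) → Set
  HasColooplessMerge {n = n} U =
    Σ (Fin n) λ i → Σ (Fin n) λ j → (i ≢ j) × (Coloopless (Uplus U i j) ⊎ Coloopless (Uminus U i j))

  merged : ∀ {d n} → Sign → (Fin n → ℤ^ d) → Fin n → Fin n → List (ℤ^ d)
  merged σ U i j = combine σ (U i) (U j) ∷ others U i j

  coloopless⇒merge : ∀ {d n} {U : Fin n → ℤ^ d} σ {i j} → i ≢ j → Coloopless (merged σ U i j) →
    HasColooplessMerge U
  coloopless⇒merge Sign.+ i≢j col = _ , _ , i≢j , inj₁ col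
  coloopless⇒merge Sign.- i≢j col = _ , _ , i≢j , inj₂ col

  record BalancedDependence {d n} (U : Fin n → ℤ^ d) (u v : Fin n) (σ : Sign) : Set where
    field
      ν     : Fin n → ℤ
      ν≢0   : ∀ i → ν i ≢ + 0
      ν-dep : IsDependence U ν
      ν-v   : ν v ≡ signed σ (ν u)

  module _ {d n} {U : Fin n → ℤ^ d} (U-inj : Injective U)
           {u v σ} (u≢v : u ≢ v) (B : BalancedDependence U u v σ) where
    open BalancedDependence B

    noCancellation⇒merge :
      (∀ {w} → w ≢ u → w ≢ v → U w ≡ combine σ (U u) (U v) → ν u + ν w ≢ + 0) → HasColooplessMerge U
    noCancellation⇒merge no-cancellation =
      coloopless⇒merge σ u≢v
        (subst (λ L → Coloopless (t ∷ L)) (sym (ListP.map-∘ K)) (coloopless-intro ps value≡𝟎 coeff≢0))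
      where
      t : ℤ^ d
      t = combine σ (U u) (U v)
      K : List (Fin n)
      K = filter (outside? u v) (allFin n)
      K! : Unique K
      K! = Unique.filter⁺ (outside? u v) (Unique.allFin⁺ n)
      ps : List (ℤ × ℤ^ d)
      ps = (ν u , t) ∷ terms U ν K
      value≡𝟎 : value ps ≡ 𝟎
      value≡𝟎 = begin
        (ν u · t) ⊕ value (terms U ν K)
          ≡⟨ cong₂ _⊕_ (·-combine σ (ν u) (U u) (U v))
                       (trans (value-terms-filter U (outside? u v) ν (allFin n))
                              (value-terms-tabulate U _ (λ i → i))) ⟩
        ((ν u · U u) ⊕ (signed σ (ν u) · U v)) ⊕ lc U ν′
          ≡⟨ cong (λ a → ((ν u · U u) ⊕ (a · U v)) ⊕ lc U ν′) ν-v ⟨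
        ((ν u · U u) ⊕ (ν v · U v)) ⊕ lc U ν′
          ≡⟨ ⊕.assoc _ _ _ ⟩
        (ν u · U u) ⊕ ((ν v · U v) ⊕ lc U ν′)
          ≡⟨ lc-pair-split U ν u≢v ⟨
        lc U ν
          ≡⟨ ν-dep ⟩
        𝟎 ∎
        where
        open ≡-Reasoning
        ν′ : Fin n → ℤ
        ν′ = restrict (outside? u v) ν
      coeff-at : ∀ {w y} → w ∈ K → U w ≡ y → coeff (terms U ν K) y ≡ ν w
      coeff-at w∈K refl = coeff-terms-∈ U U-inj ν K K! w∈K
      coeff≢0 : ∀ {y} → y ∈ List.map proj₂ ps → coeff ps y ≢ + 0
      coeff≢0 {y} y∈ps with y ≟ᵥ t | Any.any? (λ w → U w ≟ᵥ y) K
      ... | yes refl | yes hit =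
        let w , w∈K , Uw≡t = find hit
            w≢u , w≢v = proj₂ (∈-filter⁻ (outside? u v) {xs = allFin n} w∈K)
        in  subst (_≢ + 0) (cong (λ s → ν u + s) (sym (coeff-at w∈K Uw≡t)))
                  (no-cancellation w≢u w≢v Uw≡t)
      ... | yes refl | no miss =
        subst (_≢ + 0)
              (sym (trans (cong (λ s → ν u + s) (coeff-terms-∉ U ν K (λ w∈K Uw≡t → miss (lose w∈K Uw≡t))))
                          (ℤP.+-identityʳ (ν u))))
              (ν≢0 u)
      ... | no _ | yes hit =
        let w , w∈K , Uw≡y = find hit
        in  subst (_≢ + 0) (sym (trans (ℤP.+-identityˡ _) (coeff-at w∈K Uw≡y))) (ν≢0 w)
      ... | no y≢t | no miss with y∈ps
      ...   | here y≡t = ⊥-elim (y≢t y≡t)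
      ...   | there y∈ with ∈-map⁻ proj₂ y∈
      ...     | p , p∈ , refl with ∈-map⁻ _ p∈
      ...       | w , w∈K , refl = ⊥-elim (miss (lose w∈K refl))

  module FinExtrema {b ℓ₁ ℓ₂} (O : TotalOrder b ℓ₁ ℓ₂) where
    open TotalOrder O using (_≤_) renaming (Carrier to B)
    open Extrema O

    argmin-on : ∀ {n p} {P : Pred (Fin n) p} → Decidable P → (f : Fin n → B) →
      ∃ P → ∃ λ v → P v × (∀ {i} → P i → f v ≤ f i)
    argmin-on {n} P? f (i₀ , Pi₀) =
      argmin f i₀ xs , argmin-all f Pi₀ (all-filter P? (allFin n)) ,
      λ Pi → All.lookup (f[argmin]≤f[xs] i₀ xs) (∈-filter⁺ P? (∈-allFin _) Pi)
      where xs = filter P? (allFin n)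

    argmax-on : ∀ {n p} {P : Pred (Fin n) p} → Decidable P → (f : Fin n → B) →
      ∃ P → ∃ λ v → P v × (∀ {i} → P i → f i ≤ f v)
    argmax-on {n} P? f (i₀ , Pi₀) =
      argmax f i₀ xs , argmax-all f Pi₀ (all-filter P? (allFin n)) ,
      λ Pi → All.lookup (f[xs]≤f[argmax] i₀ xs) (∈-filter⁺ P? (∈-allFin _) Pi)
      where xs = filter P? (allFin n)

  ∃-∉ : ∀ {n} (xs : List (Fin n)) → List.length xs ℕ.< n → ∃ λ i → i ∉ xs
  ∃-∉ {n} xs length<n with FinP.any? (λ i → ¬? (Any.any? (i FinP.≟_) xs))
  ... | yes found = found
  ... | no none = ⊥-elim (ℕP.<⇒≱ length<n (FinP.injective⇒≤ index-injective))
    where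
    covered : ∀ i → i ∈ xs
    covered i = decidable-stable (Any.any? (i FinP.≟_) xs) (λ i∉xs → none (i , i∉xs))
    index-injective : ∀ {i j} → Any.index (covered i) ≡ Any.index (covered j) → i ≡ j
    index-injective {i} {j} eq =
      trans (lookup-index (covered i)) (trans (cong (List.lookup xs) eq) (sym (lookup-index (covered j))))

  -- Balancing

  -- |m| / |l| whenever l ≢ 0.
  ratio : ℤ → ℤ → ℚᵘ
  ratio m l = mkℚᵘ (+ ∣ m ∣) (ℕ.pred ∣ l ∣)

  ratio-≤ : ∀ {m l m′ l′} → l ≢ + 0 → l′ ≢ + 0 → ratio m l ℚᵘ.≤ ratio m′ l′ →
    ∣ m ∣ ℕ.* ∣ l′ ∣ ℕ.≤ ∣ m′ ∣ ℕ.* ∣ l ∣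
  ratio-≤ {m} {l} {m′} {l′} l≢0 l′≢0 (*≤* le) =
    subst₂ (λ a b → ∣ m ∣ ℕ.* a ℕ.≤ ∣ m′ ∣ ℕ.* b)
           (ℕP.suc-pred ∣ l′ ∣ {{ℕ.≢-nonZero (i≢0⇒∣i∣≢0 l′≢0)}})
           (ℕP.suc-pred ∣ l ∣ {{ℕ.≢-nonZero (i≢0⇒∣i∣≢0 l≢0)}})
           (ℤP.drop‿+≤+ (subst₂ ℤ._≤_ (sym (ℤP.pos-* (∣ m ∣) _)) (sym (ℤP.pos-* (∣ m′ ∣) _)) le))

  module _ {d n} {U : Fin n → ℤ^ d} {Λ μ : Fin n → ℤ} where

    balance : (∀ i → Λ i ≢ + 0) → IsDependence U Λ → IsDependence U μ → ∀ {u} → μ u ≡ + 0 →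
      ∃ (λ i → μ i ≢ + 0) → ∃₂ λ v σ → u ≢ v × BalancedDependence U u v σ
    balance Λ≢0 Λ-dep μ-dep {u} μu≡0 μ-support =
      v , σ , (λ u≡v → μv≢0 (trans (cong μ (sym u≡v)) μu≡0)) ,
      record { ν = ν ; ν≢0 = ν≢0 ; ν-dep = dependence-combination U (μ v) c Λ-dep μ-dep ; ν-v = ν-v }
      where
      open FinExtrema ℚᵘP.≤-totalOrder
      minimal : ∃ λ v → μ v ≢ + 0 × (∀ {i} → μ i ≢ + 0 → ratio (μ v) (Λ v) ℚᵘ.≤ ratio (μ i) (Λ i))
      minimal = argmin-on (λ i → ¬? (μ i ℤ.≟ + 0)) (λ i → ratio (μ i) (Λ i)) μ-support
      v : Fin n
      v = proj₁ minimal
      μv≢0 : μ v ≢ + 0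
      μv≢0 = proj₁ (proj₂ minimal)
      v-minimal : ∀ {i} → μ i ≢ + 0 → ∣ μ v ∣ ℕ.* ∣ Λ i ∣ ℕ.≤ ∣ μ i ∣ ℕ.* ∣ Λ v ∣
      v-minimal {i} μi≢0 =
        ratio-≤ {μ v} {Λ v} {μ i} {Λ i} (Λ≢0 v) (Λ≢0 i) (proj₂ (proj₂ minimal) μi≢0)
      σ : Sign
      σ = align (- Λ v) (Λ u)
      c : ℤ
      c = - Λ v + signed σ (Λ u)
      ∣c∣ : ∣ c ∣ ≡ ∣ Λ v ∣ ℕ.+ ∣ Λ u ∣
      ∣c∣ = trans (∣+align∣ (- Λ v) (Λ u)) (cong (ℕ._+ ∣ Λ u ∣) (ℤP.∣-i∣≡∣i∣ (Λ v)))
      ν : Fin n → ℤ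
      ν i = μ v * Λ i + c * μ i
      ν-v : ν v ≡ signed σ (ν u)
      ν-v rewrite μu≡0 = balanced σ (μ v) (Λ u) (Λ v)
        where
        balanced : ∀ σ m a b → m * b + (- b + signed σ a) * m ≡ signed σ (m * a + (- b + signed σ a) * + 0)
        balanced Sign.+ = identity
          where
          identity : ∀ m a b → m * b + (- b + a) * m ≡ m * a + (- b + a) * + 0
          identity = solve-∀
        balanced Sign.- = identity
          where
          identity : ∀ m a b → m * b + (- b + - a) * m ≡ - (m * a + (- b + - a) * + 0)
          identity = solve-∀
      ν≢0 : ∀ i → ν i ≢ + 0
      ν≢0 i νi≡0 with μ i ℤ.≟ + 0
      ... | yes μi≡0 = *-≢0 μv≢0 (Λ≢0 i) (begin
        μ v * Λ i            ≡⟨ ℤP.+-identityʳ _ ⟨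
        μ v * Λ i + + 0      ≡⟨ cong (λ x → μ v * Λ i + x) c*μi≡0 ⟨
        μ v * Λ i + c * μ i  ≡⟨ νi≡0 ⟩
        + 0                  ∎)
        where
        open ≡-Reasoning
        c*μi≡0 : c * μ i ≡ + 0
        c*μi≡0 = trans (cong (c *_) μi≡0) (ℤP.*-zeroʳ c)
      -- Otherwise |μ v| |Λ i| = |c| |μ i| > |Λ v| |μ i|, against the minimality of v.
      ... | no μi≢0 =
        [ i≢0⇒∣i∣≢0 (Λ≢0 u) , i≢0⇒∣i∣≢0 μi≢0 ]′
          (ℕP.m*n≡0⇒m≡0∨n≡0 _ ([m+n]*o≤o*m⇒n*o≡0 (∣ Λ v ∣) (∣ Λ u ∣) (∣ μ i ∣) too-small))
        where
        too-small : (∣ Λ v ∣ ℕ.+ ∣ Λ u ∣) ℕ.* ∣ μ i ∣ ℕ.≤ ∣ μ i ∣ ℕ.* ∣ Λ v ∣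
        too-small = subst (ℕ._≤ ∣ μ i ∣ ℕ.* ∣ Λ v ∣)
                          (trans (*+*≡0⇒∣*∣≡∣*∣ {μ v} {Λ i} {c} {μ i} νi≡0) (cong (ℕ._* ∣ μ i ∣) ∣c∣))
                          (v-minimal μi≢0)

  -- Complementary dependences

  summand≤sum : ∀ {n} (f : Fin n → ℕ) k → f k ℕ.≤ ℕΣ.sum f
  summand≤sum f Fin.zero    = ℕP.m≤m+n _ _
  summand≤sum f (Fin.suc k) = ℕP.≤-trans (summand≤sum (f ∘ Fin.suc) k) (ℕP.m≤n+m _ _)

  evalAt : ∀ {d} → ℕ → ℤ^ d → ℤ
  evalAt N []      = + 0
  evalAt N (a ∷ x) = a + + N * evalAt N x

  evalAt-combine : ∀ {d} N σ (x y : ℤ^ d) → evalAt N (combine σ x y) ≡ evalAt N x + signed σ (evalAt N y)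
  evalAt-combine N Sign.+ []      []      = refl
  evalAt-combine N Sign.- []      []      = refl
  evalAt-combine N Sign.+ (a ∷ x) (b ∷ y) =
    trans (cong (λ e → (a + b) + + N * e) (evalAt-combine N Sign.+ x y)) (identity a b (+ N) _ _)
    where
    identity : ∀ a b n p q → (a + b) + n * (p + q) ≡ (a + n * p) + (b + n * q)
    identity = solve-∀
  evalAt-combine N Sign.- (a ∷ x) (b ∷ y) =
    trans (cong (λ e → (a - b) + + N * e) (evalAt-combine N Sign.- x y)) (identity a b (+ N) _ _)
    where
    identity : ∀ a b n p q → (a - b) + n * (p + - q) ≡ (a + n * p) + - (b + n * q)
    identity = solve-∀

  evalAt≡0⇒≡𝟎 : ∀ {d} N (x : ℤ^ d) → VecAll (λ a → ∣ a ∣ ℕ.< N) x →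
    evalAt N x ≡ + 0 → x ≡ 𝟎
  evalAt≡0⇒≡𝟎 N []      _                      _      = refl
  evalAt≡0⇒≡𝟎 N (a ∷ x) (∣a∣<N VecAll.∷ x<N) eval≡0 with evalAt N x ℤ.≟ + 0
  ... | yes rest≡0 = cong₂ _∷_ a≡0 (evalAt≡0⇒≡𝟎 N x x<N rest≡0)
    where
    a≡0 : a ≡ + 0
    a≡0 = trans (sym (ℤP.+-identityʳ a))
                (trans (cong (λ e → a + e) (sym (trans (cong (+ N *_) rest≡0) (ℤP.*-zeroʳ (+ N))))) eval≡0)
  ... | no rest≢0 =
    ⊥-elim (ℕP.<⇒≱ ∣a∣<N
      (subst (N ℕ.≤_) (sym ∣a∣≡) (ℕP.m≤m*n N _ {{ℕ.≢-nonZero (i≢0⇒∣i∣≢0 rest≢0)}})))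
    where
    ∣a∣≡ : ∣ a ∣ ≡ N ℕ.* ∣ evalAt N x ∣
    ∣a∣≡ = trans (cong ∣_∣ (+≡0⇒≡- {a} {+ N * evalAt N x} eval≡0))
                 (trans (ℤP.∣-i∣≡∣i∣ (+ N * evalAt N x)) (ℤP.abs-* (+ N) (evalAt N x)))

  ‖_‖₁ : ∀ {d} → ℤ^ d → ℕ
  ‖ x ‖₁ = Vec.sum (Vec.map ∣_∣ x)

  ∣coordinate∣≤‖‖₁ : ∀ {d} (x : ℤ^ d) → VecAll (λ a → ∣ a ∣ ℕ.≤ ‖ x ‖₁) x
  ∣coordinate∣≤‖‖₁ []      = VecAll.[]
  ∣coordinate∣≤‖‖₁ (a ∷ x) =
    ℕP.m≤m+n ∣ a ∣ ‖ x ‖₁ VecAll.∷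
    VecAll.map (λ le → ℕP.≤-trans le (ℕP.m≤n+m ‖ x ‖₁ ∣ a ∣)) (∣coordinate∣≤‖‖₁ x)

  evalAt-nondegenerate : ∀ {d n} (U : Fin n → ℤ^ d) → ∃ λ N → ∀ i → evalAt N (U i) ≡ + 0 → U i ≡ 𝟎
  evalAt-nondegenerate U = suc S , λ i → evalAt≡0⇒≡𝟎 (suc S) (U i) (coordinates<suc-S i)
    where
    S : ℕ
    S = ℕΣ.sum (λ k → ‖ U k ‖₁)
    coordinates<suc-S : ∀ i → VecAll (λ a → ∣ a ∣ ℕ.< suc S) (U i)
    coordinates<suc-S i =
      VecAll.map (λ le → ℕ.s≤s (ℕP.≤-trans le (summand≤sum (λ k → ‖ U k ‖₁) i))) (∣coordinate∣≤‖‖₁ (U i))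

  Complementary : ∀ {n} → (Fin n → ℤ) → (Fin n → ℤ) → Set
  Complementary α β = ∀ i → (α i ≢ + 0 × β i ≡ + 0) ⊎ (α i ≡ + 0 × β i ≢ + 0)

  module _ {d n} {U : Fin n → ℤ^ d} {α β : Fin n → ℤ}
           (α-dep : IsDependence U α) (β-dep : IsDependence U β) (α⊥β : Complementary α β) where

    complementary-support : ∀ {a y} → β a ≢ + 0 → α y ≢ + 0 → α a ≡ + 0 × β y ≡ + 0
    complementary-support {a} {y} βa≢0 αy≢0 with α⊥β a | α⊥β y
    ... | inj₁ (_ , βa≡0) | _                 = ⊥-elim (βa≢0 βa≡0)
    ... | _               | inj₂ (αy≡0 , _)   = ⊥-elim (αy≢0 αy≡0)
    ... | inj₂ (αa≡0 , _) | inj₁ (_ , βy≡0)   = αa≡0 , βy≡0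

    complementary-balanced : ∀ {a y} → β a ≢ + 0 → α y ≢ + 0 → ∀ σ → BalancedDependence U a y σ
    complementary-balanced {a} {y} βa≢0 αy≢0 σ = record
      { ν     = x
      ; ν≢0   = x≢0
      ; ν-dep = dependence-combination U (signed σ (β a)) (α y) α-dep β-dep
      ; ν-v   = x-y
      }
      where
      x : Fin n → ℤ
      x i = signed σ (β a) * α i + α y * β i
      x-y : x y ≡ signed σ (x a)
      x-y rewrite proj₁ (complementary-support βa≢0 αy≢0) | proj₂ (complementary-support βa≢0 αy≢0) =
        balanced σ (α y) (β a)
        where
        balanced : ∀ σ p q → signed σ q * p + p * + 0 ≡ signed σ (signed σ q * + 0 + p * q)
        balanced Sign.+ = identity
          where
          identity : ∀ p q → q * p + p * + 0 ≡ q * + 0 + p * q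
          identity = solve-∀
        balanced Sign.- = identity
          where
          identity : ∀ p q → - q * p + p * + 0 ≡ - (- q * + 0 + p * q)
          identity = solve-∀
      x≢0 : ∀ i → x i ≢ + 0
      x≢0 i with α⊥β i
      ... | inj₁ (αi≢0 , βi≡0) = λ xi≡0 → *-≢0 (signed-≢0 σ βa≢0) αi≢0 (begin
        signed σ (β a) * α i        ≡⟨ ℤP.+-identityʳ _ ⟨
        signed σ (β a) * α i + + 0  ≡⟨ cong (λ e → signed σ (β a) * α i + e) αy*βi≡0 ⟨
        x i                         ≡⟨ xi≡0 ⟩
        + 0                         ∎)
        where
        open ≡-Reasoning
        αy*βi≡0 : α y * β i ≡ + 0
        αy*βi≡0 = trans (cong (α y *_) βi≡0) (ℤP.*-zeroʳ (α y))
      ... | inj₂ (αi≡0 , βi≢0) = λ xi≡0 → *-≢0 αy≢0 βi≢0 (begin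
        α y * β i                   ≡⟨ ℤP.+-identityˡ _ ⟨
        + 0 + α y * β i             ≡⟨ cong (_+ α y * β i) σβa*αi≡0 ⟨
        x i                         ≡⟨ xi≡0 ⟩
        + 0                         ∎)
        where
        open ≡-Reasoning
        σβa*αi≡0 : signed σ (β a) * α i ≡ + 0
        σβa*αi≡0 = trans (cong (signed σ (β a) *_) αi≡0) (ℤP.*-zeroʳ (signed σ (β a)))

    complementary⇒merge : Injective U → ∃ (λ i → α i ≢ + 0) → ∃ (λ i → β i ≢ + 0) →
      HasColooplessMerge U
    complementary⇒merge U-inj α-support β-support =
      noCancellation⇒merge U-inj a≢y (complementary-balanced βa≢0 αy≢0 σ)
        (λ w≢a w≢y Uw≡t _ → no-collision w≢a w≢y Uw≡t)
      where
      N : ℕ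
      N = proj₁ (evalAt-nondegenerate U)
      φ : Fin n → ℤ
      φ i = evalAt N (U i)
      φ≡0⇒𝟎 : ∀ {i} → φ i ≡ + 0 → U i ≡ 𝟎
      φ≡0⇒𝟎 = proj₂ (evalAt-nondegenerate U) _
      key : Fin n → ℕ
      key i = ∣ φ i ∣
      open FinExtrema ℕP.≤-totalOrder
      a-max : ∃ λ a → β a ≢ + 0 × (∀ {i} → β i ≢ + 0 → key i ℕ.≤ key a)
      a-max = argmax-on (λ i → ¬? (β i ℤ.≟ + 0)) key β-support
      y-max : ∃ λ y → α y ≢ + 0 × (∀ {i} → α i ≢ + 0 → key i ℕ.≤ key y)
      y-max = argmax-on (λ i → ¬? (α i ℤ.≟ + 0)) key α-support
      a y : Fin n
      a = proj₁ a-max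
      y = proj₁ y-max
      βa≢0 : β a ≢ + 0
      βa≢0 = proj₁ (proj₂ a-max)
      αy≢0 : α y ≢ + 0
      αy≢0 = proj₁ (proj₂ y-max)
      a≢y : a ≢ y
      a≢y a≡y = αy≢0 (subst (λ i → α i ≡ + 0) a≡y (proj₁ (complementary-support βa≢0 αy≢0)))
      σ : Sign
      σ = align (φ a) (φ y)
      key-merge : ∀ {w} → U w ≡ combine σ (U a) (U y) → key w ≡ key a ℕ.+ key y
      key-merge Uw≡t = trans (cong (∣_∣ ∘ evalAt N) Uw≡t)
                             (trans (cong ∣_∣ (evalAt-combine N σ (U a) (U y))) (∣+align∣ (φ a) (φ y)))
      no-collision : ∀ {w} → w ≢ a → w ≢ y → U w ≡ combine σ (U a) (U y) → ⊥
      no-collision {w} w≢a w≢y Uw≡t with α⊥β w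
      ... | inj₁ (αw≢0 , _) =
        w≢y (U-inj w y (trans Uw≡t
          (trans (cong₂ (λ s z → combine s z (U y)) σ≡+ (φ≡0⇒𝟎 φa≡0)) (⊕.identityˡ (U y)))))
        where
        φa≡0 : φ a ≡ + 0
        φa≡0 = ℤP.∣i∣≡0⇒i≡0
          (m+n≤n⇒m≡0 (key a) (subst (ℕ._≤ key y) (key-merge Uw≡t) (proj₂ (proj₂ y-max) αw≢0)))
        σ≡+ : σ ≡ Sign.+
        σ≡+ = cong (λ p → align p (φ y)) φa≡0
      ... | inj₂ (_ , βw≢0) =
        w≢a (U-inj w a (trans Uw≡t
          (trans (cong (combine σ (U a)) (φ≡0⇒𝟎 φy≡0)) (combine-𝟎ʳ σ (U a)))))
        where
        φy≡0 : φ y ≡ + 0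
        φy≡0 = ℤP.∣i∣≡0⇒i≡0
          (m+n≤m⇒n≡0 (key a) (subst (ℕ._≤ key a) (key-merge Uw≡t) (proj₂ (proj₂ a-max) βw≢0)))

  module _ {d n} {U : Fin n → ℤ^ d} {u v σ} (u≢v : u ≢ v) (B : BalancedDependence U u v σ) where
    open BalancedDependence B

    cancellation-complementary : ∀ {w} → w ≢ u → w ≢ v → ν u + ν w ≡ + 0 →
      Complementary (λ j → + 1 * ν j + - ν u * [ u ↦ + 1 , v ↦ signed σ (+ 1) , w ↦ - + 1 ] j)
                    [ u ↦ + 1 , v ↦ signed σ (+ 1) , w ↦ - + 1 ]
    cancellation-complementary {w} w≢u w≢v cancels j = classify (j FinP.≟ u) (j FinP.≟ v) (j FinP.≟ w)
      where
      δ : Fin n → ℤ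
      δ = [ u ↦ + 1 , v ↦ signed σ (+ 1) , w ↦ - + 1 ]
      α : Fin n → ℤ
      α j = + 1 * ν j + - ν u * δ j
      Split : Fin n → Set
      Split k = (α k ≢ + 0 × δ k ≡ + 0) ⊎ (α k ≡ + 0 × δ k ≢ + 0)
      δ-u : δ u ≡ + 1
      δ-u = ↦₃-first _ _ _ u≢v (λ u≡w → w≢u (sym u≡w))
      δ-v : δ v ≡ signed σ (+ 1)
      δ-v = ↦₃-second _ _ _ (λ v≡u → u≢v (sym v≡u)) (λ v≡w → w≢v (sym v≡w))
      δ-w : δ w ≡ - + 1
      δ-w = ↦₃-third _ _ _ w≢u w≢v
      at-u : Split u
      at-u = inj₂ (trans (cong (λ e → + 1 * ν u + - ν u * e) δ-u) (identity (ν u)) ,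
                   subst (_≢ + 0) (sym δ-u) (λ ()))
        where
        identity : ∀ a → + 1 * a + - a * + 1 ≡ + 0
        identity = solve-∀
      at-v : Split v
      at-v = inj₂ (trans (cong₂ (λ a e → + 1 * a + - ν u * e) ν-v δ-v) (cancel σ (ν u)) ,
                   subst (_≢ + 0) (sym δ-v) (signed-≢0 σ (λ ())))
        where
        cancel : ∀ σ a → + 1 * signed σ a + - a * signed σ (+ 1) ≡ + 0
        cancel Sign.+ = identity
          where
          identity : ∀ a → + 1 * a + - a * + 1 ≡ + 0
          identity = solve-∀
        cancel Sign.- = identity
          where
          identity : ∀ a → + 1 * - a + - a * - + 1 ≡ + 0
          identity = solve-∀
      at-w : Split w
      at-w = inj₂ (trans (cong (λ e → + 1 * ν w + - ν u * e) δ-w) (trans (identity (ν u) (ν w)) cancels) ,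
                   subst (_≢ + 0) (sym δ-w) (λ ()))
        where
        identity : ∀ a b → + 1 * b + - a * - + 1 ≡ a + b
        identity = solve-∀
      elsewhere : ∀ {k} → k ≢ u → k ≢ v → k ≢ w → Split k
      elsewhere {k} k≢u k≢v k≢w =
        inj₁ (subst (_≢ + 0) (sym (trans (cong (λ e → + 1 * ν k + - ν u * e) δk≡0) (identity (ν k) (ν u))))
                    (ν≢0 k) ,
              δk≡0)
        where
        δk≡0 : δ k ≡ + 0
        δk≡0 = ↦₃-outside _ _ _ k≢u k≢v k≢w
        identity : ∀ a b → + 1 * a + - b * + 0 ≡ a
        identity = solve-∀
      classify : Dec (j ≡ u) → Dec (j ≡ v) → Dec (j ≡ w) → Split j
      classify (yes j≡u) _         _         = subst Split (sym j≡u) at-u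
      classify (no _)    (yes j≡v) _         = subst Split (sym j≡v) at-v
      classify (no _)    (no _)    (yes j≡w) = subst Split (sym j≡w) at-w
      classify (no j≢u)  (no j≢v)  (no j≢w)  = elsewhere j≢u j≢v j≢w

    cancellation⇒merge : Injective U → ∀ {w} → w ≢ u → w ≢ v → U w ≡ combine σ (U u) (U v) →
      ν u + ν w ≡ + 0 → ∀ {i} → i ≢ u → i ≢ v → i ≢ w → HasColooplessMerge U
    cancellation⇒merge U-inj {w} w≢u w≢v Uw≡t cancels {i} i≢u i≢v i≢w =
      complementary⇒merge (dependence-combination U (+ 1) (- ν u) {ν} {δ} ν-dep δ-dep) δ-dep α⊥δ U-inj
        (i , [ proj₁ , (λ (_ , δi≢0) → ⊥-elim (δi≢0 (↦₃-outside _ _ _ i≢u i≢v i≢w))) ]′ (α⊥δ i))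
        (u , subst (_≢ + 0) (sym (↦₃-first _ _ _ u≢v (λ u≡w → w≢u (sym u≡w)))) (λ ()))
      where
      δ : Fin n → ℤ
      δ = [ u ↦ + 1 , v ↦ signed σ (+ 1) , w ↦ - + 1 ]
      δ-dep : IsDependence U δ
      δ-dep = triangle-dependence U σ Uw≡t
      α⊥δ : Complementary (λ j → + 1 * ν j + - ν u * δ j) δ
      α⊥δ = cancellation-complementary w≢u w≢v cancels

    balanced⇒merge : Injective U → 3 ℕ.< n → HasColooplessMerge U
    balanced⇒merge U-inj 3<n with FinP.any? (λ w → ¬? (w FinP.≟ u) ×-dec ¬? (w FinP.≟ v)
                                              ×-dec U w ≟ᵥ combine σ (U u) (U v)
                                              ×-dec ν u + ν w ℤ.≟ + 0)
    ... | no none =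
      noCancellation⇒merge U-inj u≢v B (λ w≢u w≢v Uw≡t cancels → none (_ , w≢u , w≢v , Uw≡t , cancels))
    ... | yes (w , w≢u , w≢v , Uw≡t , cancels) =
      let i , i∉uvw = ∃-∉ (u ∷ v ∷ w ∷ []) 3<n
      in  cancellation⇒merge U-inj w≢u w≢v Uw≡t cancels
            (i∉uvw ∘ here) (i∉uvw ∘ there ∘ here) (i∉uvw ∘ there ∘ there ∘ here)

  -- Three points on a line

  head-combine : ∀ {d} σ (x y : ℤ^ (suc d)) → Vec.head (combine σ x y) ≡ Vec.head x + signed σ (Vec.head y)
  head-combine Sign.+ (a ∷ x) (b ∷ y) = refl
  head-combine Sign.- (a ∷ x) (b ∷ y) = refl

  ℤ¹-η : (x : ℤ^ 1) → x ≡ Vec.head x ∷ []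
  ℤ¹-η (a ∷ []) = refl

  ·⊕-ℤ¹ : ∀ a b c (x y z : ℤ^ 1) →
    (a · x) ⊕ ((b · y) ⊕ (c · z)) ≡ (a * Vec.head x + (b * Vec.head y + c * Vec.head z)) ∷ []
  ·⊕-ℤ¹ a b c (x ∷ []) (y ∷ []) (z ∷ []) = refl

  module _ {n} {U : Fin n → ℤ^ 1} (U-inj : Injective U) where

    private
      p : Fin n → ℤ
      p i = Vec.head (U i)

    merge-on-line : ∀ {u v w} → u ≢ v → u ≢ w → v ≢ w → (∀ i → i ≡ u ⊎ i ≡ v ⊎ i ≡ w) → ∀ σ →
      p w ≢ + 0 → p u + signed σ (p v) ≢ + 0 → p u + signed σ (p v) ≢ p w → HasColooplessMerge U
    merge-on-line {u} {v} {w} u≢v u≢w v≢w cover σ pw≢0 t≢0 t≢pw =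
      noCancellation⇒merge U-inj u≢v B (λ w′≢u w′≢v Uw′≡t _ → no-collision w′≢u w′≢v Uw′≡t)
      where
      t : ℤ
      t = p u + signed σ (p v)
      x : Fin n → ℤ
      x = [ u ↦ p w , v ↦ signed σ (p w) , w ↦ - t ]
      x-u : x u ≡ p w
      x-u = ↦₃-first _ _ _ u≢v u≢w
      x-v : x v ≡ signed σ (p w)
      x-v = ↦₃-second _ _ _ (λ v≡u → u≢v (sym v≡u)) v≢w
      x-w : x w ≡ - t
      x-w = ↦₃-third _ _ _ (λ w≡u → u≢w (sym w≡u)) (λ w≡v → v≢w (sym w≡v))
      x≢0 : ∀ i → x i ≢ + 0
      x≢0 i with cover i
      ... | inj₁ refl        = subst (_≢ + 0) (sym x-u) pw≢0
      ... | inj₂ (inj₁ refl) = subst (_≢ + 0) (sym x-v) (signed-≢0 σ pw≢0)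
      ... | inj₂ (inj₂ refl) = subst (_≢ + 0) (sym x-w) (signed-≢0 Sign.- t≢0)
      x-dep : IsDependence U x
      x-dep = trans (lc-↦₃ U u v w _ _ _)
                    (trans (·⊕-ℤ¹ (p w) (signed σ (p w)) (- t) (U u) (U v) (U w))
                           (cong (_∷ []) (cancel σ (p u) (p v) (p w))))
        where
        cancel : ∀ σ a b c → c * a + (signed σ c * b + - (a + signed σ b) * c) ≡ + 0
        cancel Sign.+ = identity
          where
          identity : ∀ a b c → c * a + (c * b + - (a + b) * c) ≡ + 0
          identity = solve-∀
        cancel Sign.- = identity
          where
          identity : ∀ a b c → c * a + (- c * b + - (a + - b) * c) ≡ + 0
          identity = solve-∀
      B : BalancedDependence U u v σ
      B = record { ν = x ; ν≢0 = x≢0 ; ν-dep = x-dep ; ν-v = trans x-v (cong (signed σ) (sym x-u)) }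
      no-collision : ∀ {w′} → w′ ≢ u → w′ ≢ v → U w′ ≡ combine σ (U u) (U v) → ⊥
      no-collision {w′} w′≢u w′≢v Uw′≡t with cover w′
      ... | inj₁ w′≡u        = w′≢u w′≡u
      ... | inj₂ (inj₁ w′≡v) = w′≢v w′≡v
      ... | inj₂ (inj₂ refl) = t≢pw (sym (trans (cong Vec.head Uw′≡t) (head-combine σ (U u) (U v))))

  -- Of the merges a − b, a + b (leaving c) and a + c (leaving b), one leaves two distinct nonzero integers.
  three-on-line⇒merge : (U : Fin 3 → ℤ^ 1) → Injective U → HasColooplessMerge U
  three-on-line⇒merge U U-inj = decide (c ℤ.≟ + 0) (a - b ℤ.≟ c) (a + b ℤ.≟ + 0)
    where
    a b c : ℤ
    a = Vec.head (U 0F)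
    b = Vec.head (U 1F)
    c = Vec.head (U 2F)
    heads-injective : ∀ i j → Vec.head (U i) ≡ Vec.head (U j) → i ≡ j
    heads-injective i j eq = U-inj i j (trans (ℤ¹-η (U i)) (trans (cong (_∷ []) eq) (sym (ℤ¹-η (U j)))))
    a≢b : a ≢ b
    a≢b eq with () ← heads-injective 0F 1F eq
    a≢c : a ≢ c
    a≢c eq with () ← heads-injective 0F 2F eq
    b≢c : b ≢ c
    b≢c eq with () ← heads-injective 1F 2F eq
    merge-012 : ∀ σ → c ≢ + 0 → a + signed σ b ≢ + 0 → a + signed σ b ≢ c → HasColooplessMerge U
    merge-012 = merge-on-line U-inj {0F} {1F} {2F} (λ ()) (λ ()) (λ ())
      λ { 0F → inj₁ refl ; 1F → inj₂ (inj₁ refl) ; 2F → inj₂ (inj₂ refl) }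
    merge-021 : ∀ σ → b ≢ + 0 → a + signed σ c ≢ + 0 → a + signed σ c ≢ b → HasColooplessMerge U
    merge-021 = merge-on-line U-inj {0F} {2F} {1F} (λ ()) (λ ()) (λ ())
      λ { 0F → inj₁ refl ; 1F → inj₂ (inj₂ refl) ; 2F → inj₂ (inj₁ refl) }
    decide : Dec (c ≡ + 0) → Dec (a - b ≡ c) → Dec (a + b ≡ + 0) → HasColooplessMerge U
    decide (yes c≡0) _ _ =
      merge-021 Sign.+ (λ b≡0 → b≢c (trans b≡0 (sym c≡0)))
        (subst (_≢ + 0) (sym a+c≡a) (λ a≡0 → a≢c (trans a≡0 (sym c≡0))))
        (subst (_≢ b) (sym a+c≡a) a≢b)
      where
      a+c≡a : a + c ≡ a
      a+c≡a = trans (cong (λ z → a + z) c≡0) (ℤP.+-identityʳ a)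
    decide (no c≢0) (no a-b≢c) _ = merge-012 Sign.- c≢0 (a≢b ∘ ℤP.i-j≡0⇒i≡j a b) a-b≢c
    decide (no c≢0) (yes a-b≡c) (no a+b≢0) = merge-012 Sign.+ c≢0 a+b≢0 a+b≢c
      where
      b≢0 : b ≢ + 0
      b≢0 b≡0 = a≢c (trans (sym (trans (cong (λ z → a - z) b≡0) (ℤP.+-identityʳ a))) a-b≡c)
      a+b≢c : a + b ≢ c
      a+b≢c a+b≡c = *-≢0 {+ 2} (λ ()) b≢0 (begin
        + 2 * b            ≡⟨ identity a b ⟩
        (a + b) - (a - b)  ≡⟨ cong₂ _-_ a+b≡c a-b≡c ⟩
        c - c              ≡⟨ ℤP.+-inverseʳ c ⟩
        + 0                ∎)
        where
        open ≡-Reasoning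
        identity : ∀ a b → + 2 * b ≡ (a + b) - (a - b)
        identity = solve-∀
    decide (no c≢0) (yes a-b≡c) (yes a+b≡0) =
      merge-021 Sign.+ b≢0 (subst (_≢ + 0) (sym a+c≡-3b) (*-≢0 { - + 3 } (λ ()) b≢0)) a+c≢b
      where
      a≡-b : a ≡ - b
      a≡-b = +≡0⇒≡- a+b≡0
      b≢0 : b ≢ + 0
      b≢0 b≡0 = a≢b (trans a≡-b (trans (cong -_ b≡0) (sym b≡0)))
      a+c≡-3b : a + c ≡ - + 3 * b
      a+c≡-3b = begin
        a + c            ≡⟨ cong (λ z → a + z) a-b≡c ⟨
        a + (a - b)      ≡⟨ cong (λ z → z + (z - b)) a≡-b ⟩
        - b + (- b - b)  ≡⟨ identity b ⟩
        - + 3 * b        ∎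
        where
        open ≡-Reasoning
        identity : ∀ b → - b + (- b - b) ≡ - + 3 * b
        identity = solve-∀
      a+c≢b : a + c ≢ b
      a+c≢b a+c≡b = *-≢0 { - + 4 } (λ ()) b≢0 (begin
        - + 4 * b      ≡⟨ identity b ⟩
        - + 3 * b - b  ≡⟨ cong (_- b) (trans (sym a+c≡-3b) a+c≡b) ⟩
        b - b          ≡⟨ ℤP.+-inverseʳ b ⟩
        + 0            ∎)
        where
        open ≡-Reasoning
        identity : ∀ b → - + 4 * b ≡ - + 3 * b - b
        identity = solve-∀

  fewerThanFour⇒merge : ∀ {d n} (U : Fin n → ℤ^ d) → Injective U → d ℕ.+ 2 ℕ.≤ n → n ℕ.< 4 →
    HasColooplessMerge U
  fewerThanFour⇒merge {zero} {suc (suc n)} U U-inj _ _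
    with () ← U-inj Fin.zero (Fin.suc Fin.zero) (trans (ℤ^0-trivial _) (sym (ℤ^0-trivial _)))
  fewerThanFour⇒merge {suc zero} {3} U U-inj _ _ = three-on-line⇒merge U U-inj
  fewerThanFour⇒merge {suc (suc d)} _ _ d+2≤n n<4 =
    ⊥-elim (ℕP.<⇒≱ n<4 (ℕP.≤-trans (ℕ.s≤s (ℕ.s≤s (ℕP.m≤n+m 2 d))) d+2≤n))
  fewerThanFour⇒merge {zero}     {0} _ _ () _
  fewerThanFour⇒merge {zero}     {1} _ _ (ℕ.s≤s ()) _
  fewerThanFour⇒merge {suc zero} {0} _ _ () _
  fewerThanFour⇒merge {suc zero} {1} _ _ (ℕ.s≤s ()) _
  fewerThanFour⇒merge {suc zero} {2} _ _ (ℕ.s≤s (ℕ.s≤s ())) _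
  fewerThanFour⇒merge {suc zero} {suc (suc (suc (suc n)))} _ _ _ (ℕ.s≤s (ℕ.s≤s (ℕ.s≤s (ℕ.s≤s ()))))

  atLeastFour⇒merge : ∀ {d n} (U : Fin n → ℤ^ d) → Injective U → Coloopless (elems U) →
    d ℕ.+ 2 ℕ.≤ n → 4 ℕ.≤ n → HasColooplessMerge U
  atLeastFour⇒merge {d} {suc n} U U-inj U-col d+2≤n 4≤n =
    let Λ , Λ≢0 , Λ-dep = nowhereZeroDependence U U-inj U-col
        c , (j , cⱼ≢0) , c-dep = nontrivialDependence d<n (U ∘ Fin.suc)
        v , σ , 0≢v , B =
          balance {Λ = Λ} {μ = + 0 ∷ᶠ c} Λ≢0 Λ-dep (μ-dep c c-dep) {Fin.zero} refl (Fin.suc j , cⱼ≢0)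
    in  balanced⇒merge 0≢v B U-inj 4≤n
    where
    d<n : d ℕ.< n
    d<n = ℕP.≤-pred (subst (ℕ._≤ suc n) (ℕP.+-comm d 2) d+2≤n)
    μ-dep : ∀ c → IsDependence (U ∘ Fin.suc) c → IsDependence U (+ 0 ∷ᶠ c)
    μ-dep c c-dep =
      trans (cong (_⊕ lc (U ∘ Fin.suc) c) (·-zeroˡ (U Fin.zero))) (trans (⊕.identityˡ _) c-dep)

open Merging using (fewerThanFour⇒merge; atLeastFour⇒merge)
open import Data.Nat using (ℕ; _+_; _≤_; _≤?_)
open import Data.Nat.Properties using (≰⇒>)
open import Data.Fin using (Fin)
open import Data.Product using (Σ; _×_)
open import Data.Sum using (_⊎_)
open import Relation.Binary.PropositionalEquality using (_≢_)
open import Relation.Nullary using (yes; no)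

corollary3p6 : (d n : ℕ) (U : Fin n → ℤ^ d) → Injective U → HasRank d U →
    Coloopless (elems U) → d + 2 ≤ n →
    Σ (Fin n) λ i → Σ (Fin n) λ j → (i ≢ j) ×
      (Coloopless (Uplus U i j) ⊎ Coloopless (Uminus U i j))
corollary3p6 d n U U-inj _ U-coloopless d+2≤n with 4 ≤? n
... | yes 4≤n = atLeastFour⇒merge U U-inj U-coloopless d+2≤n 4≤n
... | no  4≰n = fewerThanFour⇒merge U U-inj d+2≤n (≰⇒> 4≰n)
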